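{- For every DIBI formula $P$, every DIBI model $(\mathcal X,\mathcal V)$ and all states $x,y$ of $\mathcal X$: if $x\models_{\mathcal V}P$ and $y\sqsupseteq x$ then $y\models_{\mathcal V}P$.
   Context: DIBI formulas over atoms $\mathcal{AP}$: $P,Q ::= p \mid \top \mid I \mid \bot \mid P\wedge Q \mid P\vee Q \mid P\to Q \mid P * Q \mid P \mathrel{ -\!\!*} Q \mid P \triangleright Q \mid P \multimap_r Q \mid P \multimap_l Q$. A DIBI frame is $\mathcal{X}=(X,\sqsubseteq,\oplus,\odot,E)$ with $\sqsubseteq$ a preorder on $X$, $E\subseteq X$, $\oplus,\odot:X^2\to\mathcal P(X)$, satisfying (free variables universally quantified): ($\oplus$ Down-Closed) $z\in x\oplus y$, $x\sqsupseteq x'$, $y\sqsupseteq y'$ imply $\exists z'(z\sqsupseteq z'\wedge z'\in x'\oplus y')$; ($\odot$ Up-Closed) $z\in x\odot y$, $z'\sqsupseteq z$ imply $\exists x',y'(x'\sqsupseteq x\wedge y'\sqsupseteq y\wedge z'\in x'\odot y')$; ($\oplus$ Comm.) $z\in x\oplus y\Rightarrow z\in y\oplus x$; ($\oplus$ Assoc.) $w\in t\oplus z\wedge t\in x\oplus y\Rightarrow\exists s(s\in y\oplus z\wedge w\in x\oplus s)$; ($\oplus$ Unit Existence) $\exists e\in E(x\in e\oplus x)$; ($\oplus$ Unit Coherence) $e\in E\wedge x\in y\oplus e\Rightarrow x\sqsupseteq y$; ($\odot$ Assoc.) $\exists t(w\in t\odot z\wedge t\in x\odot y)\Leftrightarrow\exists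 s(s\in y\odot z\wedge w\in x\odot s)$; ($\odot$ Unit Existence$_L$) $\exists e\in E(x\in e\odot x)$; ($\odot$ Unit Existence$_R$) $\exists e\in E(x\in x\odot e)$; ($\odot$ Coherence$_R$) $e\in E\wedge x\in y\odot e\Rightarrow x\sqsupseteq y$; (Unit Closure) $e\in E\wedge e'\sqsupseteq e\Rightarrow e'\in E$; (Reverse Exchange) $x\in y\oplus z\wedge y\in y_1\odot y_2\wedge z\in z_1\odot z_2\Rightarrow\exists u,v(u\in y_1\oplus z_1\wedge v\in y_2\oplus z_2\wedge x\in u\odot v)$. A persistent valuation is $\mathcal V:\mathcal{AP}\to\mathcal P(X)$ with $x\in\mathcal V(p)$ and $y\sqsupseteq x$ implying $y\in\mathcal V(p)$; a DIBI model is a frame with a persistent valuation. Satisfaction: $x\models\top$ always; $x\models\bot$ never; $x\models I$ iff $x\in E$; $x\models p$ iff $x\in\mathcal V(p)$; $\wedge,\vee$ pointwise; $x\models P\to Q$ iff for all $y\sqsupseteq x$, $y\models P$ implies $y\models Q$; $x\models P*Q$ iff there are $x',y,z$ with $x\sqsupseteq x'\in y\oplus z$, $y\models P$, $z\models Q$; $x\models P\triangleright Q$ iff there are $y,z$ with $x\in y\odot z$, $y\models P$, $z\models Q$; $x\models P\mathrel{ -\!\!*}Q$ iff for all $y,z$ with $z\in x\oplus y$, $y\models P$ implies $z\models Q$; $x\models P\multimap_r Q$ iff for all $x',y,z$ with $x'\sqsupseteq x$, $z\in x'\odot y$, $y\models P$ implies $z\models Q$; $x\models P\multimap_l Q$ iff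 for all $x',y,z$ with $x'\sqsupseteq x$, $z\in y\odot x'$, $y\models P$ implies $z\models Q$. -}

module Defs where

open import Level using (Level; _⊔_; suc)
open import Data.Product using (Σ; ∃; ∃-syntax; _×_; _,_)
open import Data.Sum using (_⊎_)
open import Data.Unit.Polymorphic using (⊤)
open import Data.Empty.Polymorphic using (⊥)
open import Relation.Binary.Structures using (IsPreorder)
open import Relation.Binary.PropositionalEquality using (_≡_)

data Formula (AP : Set) : Set where
  atom  : AP → Formula AP
  `⊤ `I `⊥ : Formula AP
  _`∧_ _`∨_ _`→_ _`*_ _`-*_ _`▷_ _`⊸r_ _`⊸l_ : Formula AP → Formula AP → Formula AP

-- The nondeterministic operations ⊕,⊙ : X² → P(X) are given as
-- ternary relations:  Plus x y z  means  z ∈ x ⊕ y ;  Dot x y z  means  z ∈ x ⊙ y.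
-- x ⊑ y is the preorder; "y ⊒ x" is written  x ⊑ y.
record DIBIFrame (a ℓ : Level) : Set (suc (a ⊔ ℓ)) where
  field
    X    : Set a
    _⊑_  : X → X → Set ℓ
    Plus : X → X → X → Set ℓ
    Dot  : X → X → X → Set ℓ
    E    : X → Set ℓ
    ⊑-isPreorder : IsPreorder _≡_ _⊑_
    ⊕-downClosed : ∀ {x y z x' y'} → Plus x y z → x' ⊑ x → y' ⊑ y →
                   ∃[ z' ] (z' ⊑ z × Plus x' y' z')
    ⊙-upClosed : ∀ {x y z z'} → Dot x y z → z ⊑ z' →
                 ∃[ x' ] ∃[ y' ] (x ⊑ x' × y ⊑ y' × Dot x' y' z')
    ⊕-comm : ∀ {x y z} → Plus x y z → Plus y x z
    ⊕-assoc : ∀ {x y z t w} → Plus t z w → Plus x y t →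
              ∃[ s ] (Plus y z s × Plus x s w)
    ⊕-unitExist : ∀ x → ∃[ e ] (E e × Plus e x x)
    ⊕-unitCoh : ∀ {e x y} → E e → Plus y e x → y ⊑ x
    ⊙-assocʳ : ∀ {x y z w} → (∃[ t ] (Dot t z w × Dot x y t)) →
               ∃[ s ] (Dot y z s × Dot x s w)
    ⊙-assocˡ : ∀ {x y z w} → (∃[ s ] (Dot y z s × Dot x s w)) →
               ∃[ t ] (Dot t z w × Dot x y t)
    ⊙-unitExistL : ∀ x → ∃[ e ] (E e × Dot e x x)
    ⊙-unitExistR : ∀ x → ∃[ e ] (E e × Dot x e x)
    ⊙-cohR : ∀ {e x y} → E e → Dot y e x → y ⊑ x
    unitClosure : ∀ {e e'} → E e → e ⊑ e' → E e'
    revExchange : ∀ {x y z y₁ y₂ z₁ z₂} → Plus y z x → Dot y₁ y₂ y → Dot z₁ z₂ z →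
                  ∃[ u ] ∃[ v ] (Plus y₁ z₁ u × Plus y₂ z₂ v × Dot u v x)

record DIBIModel (AP : Set) (a ℓ : Level) : Set (suc (a ⊔ ℓ)) where
  field
    frame : DIBIFrame a ℓ
  open DIBIFrame frame public
  field
    V : AP → X → Set ℓ
    V-persistent : ∀ {p x y} → V p x → x ⊑ y → V p y

module _ {AP : Set} {a ℓ : Level} (M : DIBIModel AP a ℓ) where
  open DIBIModel M

  _⊨_ : X → Formula AP → Set (a ⊔ ℓ)
  x ⊨ atom p   = Level.Lift a (V p x)
  x ⊨ `⊤       = ⊤
  x ⊨ `I       = Level.Lift a (E x)
  x ⊨ `⊥       = ⊥
  x ⊨ (P `∧ Q) = x ⊨ P × x ⊨ Q
  x ⊨ (P `∨ Q) = x ⊨ P ⊎ x ⊨ Q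
  x ⊨ (P `→ Q) = ∀ y → x ⊑ y → y ⊨ P → y ⊨ Q
  x ⊨ (P `* Q) = ∃[ x' ] ∃[ y ] ∃[ z ] (x' ⊑ x × Plus y z x' × y ⊨ P × z ⊨ Q)
  x ⊨ (P `▷ Q) = ∃[ y ] ∃[ z ] (Dot y z x × y ⊨ P × z ⊨ Q)
  x ⊨ (P `-* Q) = ∀ y z → Plus x y z → y ⊨ P → z ⊨ Q
  x ⊨ (P `⊸r Q) = ∀ x' y z → x ⊑ x' → Dot x' y z → y ⊨ P → z ⊨ Q
  x ⊨ (P `⊸l Q) = ∀ x' y z → x ⊑ x' → Dot y x' z → y ⊨ P → z ⊨ Q

{-# OPTIONS --safe #-}
module Submission where

open import Defs
open import Level using (Level; lift)
open import Data.Product using (_,_)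
open import Data.Sum using (inj₁; inj₂)
open import Relation.Binary.Structures using (IsPreorder)

-- The implications already quantify over all
-- ⊑-larger states and * is existential below the current state, so those cases
-- only need transitivity; -* needs (⊕ Down-Closed), ▷ needs (⊙ Up-Closed), and
-- I needs (Unit Closure).
module Persistence {AP : Set} {a ℓ : Level} (M : DIBIModel AP a ℓ) where
  open DIBIModel M
  open IsPreorder ⊑-isPreorder using (refl; trans)

  ⊨-mono : ∀ (P : Formula AP) {x y} → _⊨_ M x P → x ⊑ y → _⊨_ M y P
  ⊨-mono (atom p)   (lift h)  x⊑y = lift (V-persistent h x⊑y)
  ⊨-mono `⊤         h         x⊑y = h
  ⊨-mono `I         (lift e)  x⊑y = lift (unitClosure e x⊑y)
  ⊨-mono (P `∧ Q)   (p , q)   x⊑y = ⊨-mono P p x⊑y , ⊨-mono Q q x⊑y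
  ⊨-mono (P `∨ Q)   (inj₁ p)  x⊑y = inj₁ (⊨-mono P p x⊑y)
  ⊨-mono (P `∨ Q)   (inj₂ q)  x⊑y = inj₂ (⊨-mono Q q x⊑y)
  ⊨-mono (P `→ Q)   h         x⊑y = λ w y⊑w → h w (trans x⊑y y⊑w)
  ⊨-mono (P `* Q)   (x' , u , v , x'⊑x , x'∈u⊕v , p , q) x⊑y =
    x' , u , v , trans x'⊑x x⊑y , x'∈u⊕v , p , q
  ⊨-mono (P `-* Q)  h         x⊑y = λ w z z∈y⊕w p →
    let (z' , z'⊑z , z'∈x⊕w) = ⊕-downClosed z∈y⊕w x⊑y refl
    in ⊨-mono Q (h w z' z'∈x⊕w p) z'⊑z
  ⊨-mono (P `▷ Q)   (u , v , x∈u⊙v , p , q) x⊑y =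
    let (u' , v' , u⊑u' , v⊑v' , y∈u'⊙v') = ⊙-upClosed x∈u⊙v x⊑y
    in u' , v' , y∈u'⊙v' , ⊨-mono P p u⊑u' , ⊨-mono Q q v⊑v'
  ⊨-mono (P `⊸r Q)  h         x⊑y = λ x' w z y⊑x' → h x' w z (trans x⊑y y⊑x')
  ⊨-mono (P `⊸l Q)  h         x⊑y = λ x' w z y⊑x' → h x' w z (trans x⊑y y⊑x')

mainTheorem6 : ∀ {AP : Set} {a ℓ : Level} (M : DIBIModel AP a ℓ) (P : Formula AP)
    (x y : DIBIModel.X M) →
    _⊨_ M x P → DIBIModel._⊑_ M x y → _⊨_ M y P
mainTheorem6 M P _ _ = Persistence.⊨-mono M P
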